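{- Let $\alpha$ be a strong composition. Then both $\mathfrak{F}_\alpha$ and $\mathfrak{F}_{\mathrm{sort}(\alpha)}$ are (not necessarily distinct) terms in the expansion of $\kappa_\alpha$ into fundamental slide polynomials; that is, there exist $T,T'\in\mathrm{QKT}(\alpha)$ with $\mathrm{wt}(T)=\alpha$ and $\mathrm{wt}(T')=\mathrm{sort}(\alpha)$.
   Context: A weak composition $a=(a_1,\dots,a_\ell)$ of length $\ell$ is a finite sequence of nonnegative integers; a strong composition is one whose parts are all positive; $\mathrm{sort}(\alpha)$ is the partition (of the same length, for $\alpha$ strong) obtained by rearranging the parts of $\alpha$ in weakly decreasing order. A diagram is a finite set of cells $(r,c)$ with $r,c$ positive integers (row $r$ from the bottom, column $c$ from the left). A Kohnert tableau of content $a$ is a diagram filled with positive integers, exactly $a_i$ cells containing $i$ for each $i$, such that: (i) for each $i$ there is exactly one $i$ in each of the columns $1,\dots,a_i$; (ii) every entry in row $r$ is at least $r$; (iii) for each $i$, the cells containing $i$ weakly descend from left to right; (iv) if $i<j$ appear in the same column with $i$ above $j$, then there is an $i$ in the column immediately to the right of the cell containing that $j$, in a row strictly above it. It is quasi-Yamanouchi if moreover (v) for each nonempty row $r$, either row $r$ contains an entry equal to $r$, or some cell of row $r+1$ lies weakly to the right of some cell of row $r$. $\mathrm{QKT}(a)$ is the set of quasi-Yamanouchi Kohnert tableaux of content $a$, and $\mathrm{wt}(T)$ is the weak composition of length $\ell$ whose $r$-th part is the number of cells in row $r$ of $T$. The key polynomial $\kappa_a$ satisfies $\kappa_a=\sum_{T\in\mathrm{QKT}(a)}\mathfrak{F}_{\mathrm{wt}(T)}$,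 where $\mathfrak{F}_b$ is the fundamental slide polynomial. -}

module Defs where

open import Data.Nat using (ℕ; zero; suc; _≤_; _<_; _≟_)
open import Data.Nat.Properties using (≤-decTotalOrder)
open import Data.List using (List; []; _∷_; length; filter; map; upTo)
open import Data.List.Relation.Unary.All using (All)
open import Data.List.Relation.Unary.Unique.Propositional using (Unique)
open import Data.List.Membership.Propositional using (_∈_)
open import Data.Product using (_×_; _,_; ∃-syntax)
open import Data.Sum using (_⊎_)
open import Relation.Binary.PropositionalEquality using (_≡_)
open import Relation.Nullary.Decidable using (_×-dec_)
import Relation.Binary.Properties.DecTotalOrder as DTO
import Data.List.Sort as Sort

-- Compositions are lists of naturals; positions are 1-indexed.
-- part a i = a_i for 1 ≤ i ≤ length a, and 0 otherwise.
part : List ℕ → ℕ → ℕ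
part []       _             = 0
part (x ∷ xs) zero          = 0
part (x ∷ xs) (suc zero)    = x
part (x ∷ xs) (suc (suc i)) = part xs (suc i)

Strong : List ℕ → Set
Strong α = All (λ x → 1 ≤ x) α

sortDesc : List ℕ → List ℕ
sortDesc = Sort.sort (DTO.≥-decTotalOrder ≤-decTotalOrder)

-- A filled cell: position (row, col) (row from the bottom, col from the left,
-- both positive) together with its entry.
record Cell : Set where
  constructor cell
  field
    row   : ℕ
    col   : ℕ
    entry : ℕ
open Cell public

-- A filled diagram: a finite list of filled cells, with distinct positions.
Filling : Set
Filling = List Cell

pos : Cell → ℕ × ℕ
pos x = row x , col x

countEntry : ℕ → Filling → ℕ
countEntry i T = length (filter (λ x → entry x ≟ i) T)

countEntryCol : ℕ → ℕ → Filling → ℕ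
countEntryCol i c T = length (filter (λ x → (entry x ≟ i) ×-dec (col x ≟ c)) T)

countRow : ℕ → Filling → ℕ
countRow r T = length (filter (λ x → row x ≟ r) T)

wt : ℕ → Filling → List ℕ
wt ℓ T = map (λ k → countRow (suc k) T) (upTo ℓ)

record IsKohnertTableau (a : List ℕ) (T : Filling) : Set where
  field
    cellsPositive : All (λ x → (1 ≤ row x) × (1 ≤ col x)) T
    distinctCells : Unique (map pos T)
    entriesInRange : All (λ x → (1 ≤ entry x) × (entry x ≤ length a)) T
    content  : ∀ i → 1 ≤ i → i ≤ length a → countEntry i T ≡ part a i
    oneInEachColumn : ∀ i → 1 ≤ i → i ≤ length a →
                      ∀ c → 1 ≤ c → c ≤ part a i → countEntryCol i c T ≡ 1
    entryBelowRow : All (λ x → row x ≤ entry x) T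
    weaklyDescend : ∀ x y → x ∈ T → y ∈ T → entry x ≡ entry y →
                    col x < col y → row y ≤ row x
    columnCondition : ∀ x y → x ∈ T → y ∈ T → col x ≡ col y →
                      entry x < entry y → row y < row x →
                      ∃[ z ] (z ∈ T × entry z ≡ entry x × col z ≡ suc (col y)
                              × row y < row z)

QuasiYamanouchi : Filling → Set
QuasiYamanouchi T =
  ∀ x → x ∈ T →
    (∃[ y ] (y ∈ T × row y ≡ row x × entry y ≡ row x))
    ⊎ (∃[ y ] ∃[ z ] (y ∈ T × z ∈ T × row y ≡ suc (row x) × row z ≡ row x
                      × col z ≤ col y))

IsQKT : List ℕ → Filling → Set
IsQKT a T = IsKohnertTableau a T × QuasiYamanouchi T

-- Both tableaux keep the entry i in each box of row i of the key diagram of α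
-- (row i has α_i boxes) and only move each box (c, i) down its column c, to a
-- row ρ(c, i) ≤ i.  If ρ(1, i) = i and ρ weakly decreases along rows and
-- strictly increases up columns, the result is a quasi-Yamanouchi Kohnert
-- tableau: a smaller entry never lies above a larger one in the same column,
-- so (iv) is vacuous, and the first-column cell with entry r witnesses (v)
-- for row r.  ρ(c, i) = i leaves the key diagram in place, of weight α.
-- ρ(c, i) = 1 + #{j < i | α_j ≥ c} drops every column to the bottom, so
-- column c fills rows 1, …, #{j | α_j ≥ c}; this height does not change when
-- α is sorted, hence row r has #{c | c ≤ sort(α)_r} = sort(α)_r cells.
module Submission where

open import Defs
open import Data.Empty using (⊥-elim)
open import Data.List using (List; []; _∷_; length; filter; map; applyUpTo; _++_; [_])
open import Data.List.Membership.Propositional using (_∈_)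
open import Data.List.Membership.Propositional.Properties using (∈-++⁻; ∈-++⁺ˡ; ∈-++⁺ʳ; ∈-map⁻)
open import Data.List.Properties using (filter-++; filter-none; length-++; map-++; map-applyUpTo)
open import Data.List.Relation.Binary.Permutation.Propositional using (_↭_; ↭-sym)
open import Data.List.Relation.Binary.Permutation.Propositional.Properties using (↭-length; filter-↭)
open import Data.List.Relation.Unary.All as All using (All; []; _∷_)
open import Data.List.Relation.Unary.AllPairs using ([]; _∷_)
open import Data.List.Relation.Unary.Any using (here; there)
open import Data.List.Relation.Unary.Linked as Linked using (Linked)
open import Data.List.Relation.Unary.Linked.Properties using (Linked⇒AllPairs)
open import Data.List.Relation.Unary.Unique.Propositional using (Unique)
import Data.List.Relation.Unary.Unique.Propositional.Properties as Unique
import Data.List.Sort as Sort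
open import Data.Nat using (ℕ; zero; suc; _+_; _⊓_; _≤_; _<_; _≥_; z≤n; s≤s; s≤s⁻¹; pred)
open import Data.Nat.ListAction using (sum)
open import Data.Nat.ListAction.Properties using (sum-↭)
open import Data.Nat.Properties
open import Algebra.Properties.CommutativeSemigroup +-commutativeSemigroup using (x∙yz≈y∙xz)
open import Data.Product using (_×_; _,_; ∃-syntax; proj₁; proj₂)
open import Data.Sum using (inj₁; inj₂)
open import Function using (_∘_)
open import Relation.Binary.Definitions using (tri<; tri≈; tri>)
open import Relation.Binary.PropositionalEquality hiding ([_])
import Relation.Binary.Properties.DecTotalOrder as DecTotalOrder
open import Relation.Nullary using (Dec; yes; no; ¬_)
open import Relation.Nullary.Decidable using (_×-dec_)
open import Relation.Unary using (Decidable)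

𝟙 : {P : Set} → Dec P → ℕ
𝟙 (yes _) = 1
𝟙 (no _)  = 0

𝟙-yes : {P : Set} (p? : Dec P) → P → 𝟙 p? ≡ 1
𝟙-yes (yes _) _ = refl
𝟙-yes (no ¬p) p = ⊥-elim (¬p p)

𝟙-no : {P : Set} (p? : Dec P) → ¬ P → 𝟙 p? ≡ 0
𝟙-no (yes p) ¬p = ⊥-elim (¬p p)
𝟙-no (no _)  _  = refl

𝟙≤1 : {P : Set} (p? : Dec P) → 𝟙 p? ≤ 1
𝟙≤1 (yes _) = s≤s z≤n
𝟙≤1 (no _)  = z≤n

𝟙-cong : {P Q : Set} → (P → Q) → (Q → P) → (p? : Dec P) (q? : Dec Q) → 𝟙 p? ≡ 𝟙 q?
𝟙-cong _   _   (yes _) (yes _) = refl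
𝟙-cong P⇒Q _   (yes p) (no ¬q) = ⊥-elim (¬q (P⇒Q p))
𝟙-cong _   Q⇒P (no ¬p) (yes q) = ⊥-elim (¬p (Q⇒P q))
𝟙-cong _   _   (no _)  (no _)  = refl

𝟙-antitone : ∀ {c c′} a → c ≤ c′ → 𝟙 (c′ ≤? a) ≤ 𝟙 (c ≤? a)
𝟙-antitone {c} {c′} a c≤c′ with c′ ≤? a
... | yes c′≤a = ≤-reflexive (sym (𝟙-yes (c ≤? a) (≤-trans c≤c′ c′≤a)))
... | no  _    = z≤n

𝟙-≤-suc : ∀ r k → 𝟙 (suc k ≟ suc r) + 𝟙 (suc r ≤? k) ≡ 𝟙 (suc r ≤? suc k)
𝟙-≤-suc r k with <-cmp r k
... | tri< r<k r≢k _ = trans (cong₂ _+_ (𝟙-no (suc k ≟ suc r) (r≢k ∘ sym ∘ suc-injective))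
                                        (𝟙-yes (suc r ≤? k) r<k))
                             (sym (𝟙-yes (suc r ≤? suc k) (m≤n⇒m≤1+n r<k)))
... | tri≈ _ refl _  = trans (cong₂ _+_ (𝟙-yes (suc r ≟ suc r) refl) (𝟙-no (suc r ≤? r) (n≮n r)))
                             (sym (𝟙-yes (suc r ≤? suc r) ≤-refl))
... | tri> _ r≢k k<r = trans (cong₂ _+_ (𝟙-no (suc k ≟ suc r) (r≢k ∘ sym ∘ suc-injective))
                                        (𝟙-no (suc r ≤? k) (<⇒≱ (m<n⇒m<1+n k<r))))
                             (sym (𝟙-no (suc r ≤? suc k) (<⇒≱ (s≤s k<r))))

singletonIf : {A B : Set} → Dec B → A → List A
singletonIf (yes _) x = [ x ]
singletonIf (no _)  _ = []

∈-singletonIf⁻ : {A B : Set} {b? : Dec B} {x y : A} → x ∈ singletonIf b? y → B × x ≡ y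
∈-singletonIf⁻ {b? = yes b} (here x≡y) = b , x≡y

∈-singletonIf⁺ : {A B : Set} (b? : Dec B) {y : A} → B → y ∈ singletonIf b? y
∈-singletonIf⁺ (yes _) _ = here refl
∈-singletonIf⁺ (no ¬b) b = ⊥-elim (¬b b)

Unique-map-singletonIf : {A B C : Set} (f : A → C) (b? : Dec B) (y : A) → Unique (map f (singletonIf b? y))
Unique-map-singletonIf f (yes _) y = [] ∷ []
Unique-map-singletonIf f (no _)  y = []

module _ {A : Set} {P : A → Set} (P? : Decidable P) where

  count : List A → ℕ
  count xs = length (filter P? xs)

  count-∷ : ∀ x xs → count (x ∷ xs) ≡ 𝟙 (P? x) + count xs
  count-∷ x xs with P? x
  ... | yes _ = refl
  ... | no  _ = refl

  count-++ : ∀ xs ys → count (xs ++ ys) ≡ count xs + count ys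
  count-++ xs ys = trans (cong length (filter-++ P? xs ys)) (length-++ (filter P? xs))

  count-none : ∀ xs → (∀ {x} → x ∈ xs → ¬ P x) → count xs ≡ 0
  count-none xs none = cong length (filter-none P? (All.tabulate none))

  count-singletonIf : {B : Set} (b? : Dec B) {x : A} → P x → count (singletonIf b? x) ≡ 𝟙 b?
  count-singletonIf (yes _) {x} p with P? x
  ... | yes _ = refl
  ... | no ¬p = ⊥-elim (¬p p)
  count-singletonIf (no _) _ = refl

count-cong : {A : Set} {P Q : A → Set} (P? : Decidable P) (Q? : Decidable Q) → ∀ xs →
             (∀ {x} → x ∈ xs → P x → Q x) → (∀ {x} → x ∈ xs → Q x → P x) →
             count P? xs ≡ count Q? xs
count-cong P? Q? []       _   _   = refl
count-cong P? Q? (x ∷ xs) P⇒Q Q⇒P = begin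
  count P? (x ∷ xs)      ≡⟨ count-∷ P? x xs ⟩
  𝟙 (P? x) + count P? xs ≡⟨ cong₂ _+_ (𝟙-cong (P⇒Q (here refl)) (Q⇒P (here refl)) (P? x) (Q? x))
                                      (count-cong P? Q? xs (P⇒Q ∘ there) (Q⇒P ∘ there)) ⟩
  𝟙 (Q? x) + count Q? xs ≡⟨ sym (count-∷ Q? x xs) ⟩
  count Q? (x ∷ xs)      ∎
  where open ≡-Reasoning

entry≟ : (i : ℕ) → Decidable (λ x → entry x ≡ i)
entry≟ i x = entry x ≟ i

row≟ : (r : ℕ) → Decidable (λ x → row x ≡ r)
row≟ r x = row x ≟ r

entry,col≟ : (i c : ℕ) → Decidable (λ x → entry x ≡ i × col x ≡ c)
entry,col≟ i c x = (entry x ≟ i) ×-dec (col x ≟ c)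

sumTo : ℕ → (ℕ → ℕ) → ℕ
sumTo zero    f = 0
sumTo (suc m) f = f (suc m) + sumTo m f

sumTo-cong : ∀ m {f g} → (∀ {c} → 1 ≤ c → c ≤ m → f c ≡ g c) → sumTo m f ≡ sumTo m g
sumTo-cong zero    f≗g = refl
sumTo-cong (suc m) f≗g =
  cong₂ _+_ (f≗g (s≤s z≤n) ≤-refl) (sumTo-cong m (λ 1≤c → f≗g 1≤c ∘ m≤n⇒m≤1+n))

sumTo-zero : ∀ m {f} → (∀ {c} → 1 ≤ c → c ≤ m → f c ≡ 0) → sumTo m f ≡ 0
sumTo-zero zero    f≗0 = refl
sumTo-zero (suc m) f≗0 =
  cong₂ _+_ (f≗0 (s≤s z≤n) ≤-refl) (sumTo-zero m (λ 1≤c → f≗0 1≤c ∘ m≤n⇒m≤1+n))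

sumTo-one : ∀ m {f} → (∀ {c} → 1 ≤ c → c ≤ m → f c ≡ 1) → sumTo m f ≡ m
sumTo-one zero    f≗1 = refl
sumTo-one (suc m) f≗1 =
  cong₂ _+_ (f≗1 (s≤s z≤n) ≤-refl) (sumTo-one m (λ 1≤c → f≗1 1≤c ∘ m≤n⇒m≤1+n))

sumTo-mono : ∀ m {f g} → (∀ c → f c ≤ g c) → sumTo m f ≤ sumTo m g
sumTo-mono zero    f≤g = z≤n
sumTo-mono (suc m) f≤g = +-mono-≤ (f≤g (suc m)) (sumTo-mono m f≤g)

sumTo-monoˡ : ∀ {m n} f → m ≤ n → sumTo m f ≤ sumTo n f
sumTo-monoˡ {n = zero}  f z≤n = z≤n
sumTo-monoˡ {n = suc n} f m≤n with m≤n⇒m<n∨m≡n m≤n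
... | inj₁ m<n  = ≤-trans (sumTo-monoˡ f (s≤s⁻¹ m<n)) (m≤n+m _ (f (suc n)))
... | inj₂ refl = ≤-refl

sumTo-≤ : ∀ m {f} → (∀ c → f c ≤ 1) → sumTo m f ≤ m
sumTo-≤ m f≤1 = ≤-trans (sumTo-mono m f≤1) (≤-reflexive (sumTo-one m (λ _ _ → refl)))

sumTo-suc : ∀ m g → sumTo (suc m) g ≡ g 1 + sumTo m (g ∘ suc)
sumTo-suc zero    g = refl
sumTo-suc (suc m) g = trans (cong (g (suc (suc m)) +_) (sumTo-suc m g)) (x∙yz≈y∙xz (g (suc (suc m))) (g 1) _)

sumTo-𝟙≤ : ∀ m a → sumTo m (λ c → 𝟙 (c ≤? a)) ≡ m ⊓ a
sumTo-𝟙≤ zero    a = refl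
sumTo-𝟙≤ (suc m) a with suc m ≤? a
... | yes m<a = trans (cong suc (trans (sumTo-𝟙≤ m a) (m≤n⇒m⊓n≡m (<⇒≤ m<a))))
                      (sym (m≤n⇒m⊓n≡m m<a))
... | no  m≮a = trans (sumTo-𝟙≤ m a) (trans (m≥n⇒m⊓n≡n a≤m)
                      (sym (m≥n⇒m⊓n≡n (m≤n⇒m≤1+n a≤m))))
  where a≤m = s≤s⁻¹ (≰⇒> m≮a)

sumTo-𝟙≟ : ∀ m {c₀} → 1 ≤ c₀ → c₀ ≤ m → sumTo m (λ c → 𝟙 (c ≟ c₀)) ≡ 1
sumTo-𝟙≟ zero    (s≤s _) ()
sumTo-𝟙≟ (suc m) {c₀} 1≤c₀ c₀≤m with m≤n⇒m<n∨m≡n c₀≤m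
... | inj₁ c₀<m = cong₂ _+_ (𝟙-no (suc m ≟ c₀) (<⇒≢ c₀<m ∘ sym))
                            (sumTo-𝟙≟ m 1≤c₀ (s≤s⁻¹ c₀<m))
... | inj₂ refl = cong₂ _+_ (𝟙-yes (suc m ≟ suc m) refl)
                            (sumTo-zero m (λ {c} _ c≤m → 𝟙-no (c ≟ suc m) (<⇒≢ (s≤s c≤m))))

part≤sum : ∀ α i → part α i ≤ sum α
part≤sum []       _             = z≤n
part≤sum (x ∷ xs) zero          = z≤n
part≤sum (x ∷ xs) (suc zero)    = m≤m+n x (sum xs)
part≤sum (x ∷ xs) (suc (suc i)) = ≤-trans (part≤sum xs (suc i)) (m≤n+m (sum xs) x)

part≤ : ∀ {a} xs → All (_≤ a) xs → ∀ i → part xs i ≤ a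
part≤ []       _          _             = z≤n
part≤ (x ∷ xs) _          zero          = z≤n
part≤ (x ∷ xs) (x≤a ∷ _)  (suc zero)    = x≤a
part≤ (x ∷ xs) (_ ∷ xs≤a) (suc (suc i)) = part≤ xs xs≤a (suc i)

1≤part⇒index : ∀ α {i} → 1 ≤ part α i → 1 ≤ i × i ≤ length α
1≤part⇒index (x ∷ xs) {suc zero}    _   = s≤s z≤n , s≤s z≤n
1≤part⇒index (x ∷ xs) {suc (suc i)} 1≤p = s≤s z≤n , s≤s (proj₂ (1≤part⇒index xs 1≤p))

Strong⇒1≤part : ∀ {α} → Strong α → ∀ {i} → 1 ≤ i → i ≤ length α → 1 ≤ part α i
Strong⇒1≤part (1≤x ∷ _)  {suc zero}    _ _         = 1≤x
Strong⇒1≤part (_ ∷ 1≤xs) {suc (suc i)} _ (s≤s i≤ℓ) = Strong⇒1≤part 1≤xs (s≤s z≤n) i≤ℓ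

-- rowOf c i is ρ(c, i): the row receiving the box in column c of row i of the
-- key diagram of α.
record RowAssignment (α : List ℕ) : Set where
  field
    rowOf             : ℕ → ℕ → ℕ
    rowOf-positive    : ∀ {c i} → 1 ≤ c → c ≤ part α i → 1 ≤ rowOf c i
    rowOf≤entry       : ∀ {c i} → 1 ≤ c → c ≤ part α i → rowOf c i ≤ i
    rowOf-firstColumn : ∀ {i} → 1 ≤ i → i ≤ length α → rowOf 1 i ≡ i
    rowOf-antitone    : ∀ {c c′ i} → 1 ≤ c → c < c′ → c′ ≤ part α i → rowOf c′ i ≤ rowOf c i
    rowOf-strictMono  : ∀ {c i j} → 1 ≤ c → c ≤ part α i → c ≤ part α j → i < j →
                        rowOf c i < rowOf c j

module KeyFilling (α : List ℕ) (rowOf : ℕ → ℕ → ℕ) where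

  ℓ : ℕ
  ℓ = length α

  boxIf : ℕ → ℕ → Filling
  boxIf c i = singletonIf (c ≤? part α i) (cell (rowOf c i) c i)

  column : ℕ → ℕ → Filling
  column c zero    = []
  column c (suc n) = boxIf c (suc n) ++ column c n

  columnsUpTo : ℕ → Filling
  columnsUpTo zero    = []
  columnsUpTo (suc m) = column (suc m) ℓ ++ columnsUpTo m

  -- sum α bounds every part, so no box lies beyond column sum α.
  filling : Filling
  filling = columnsUpTo (sum α)

  data Placed : Cell → Set where
    placed : ∀ {c i} → 1 ≤ c → c ≤ part α i → Placed (cell (rowOf c i) c i)

  ∈column⁻ : ∀ c n {x} → x ∈ column c n →
             ∃[ i ] (i ≤ n × c ≤ part α i × x ≡ cell (rowOf c i) c i)
  ∈column⁻ c (suc n) x∈ with ∈-++⁻ (boxIf c (suc n)) x∈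
  ... | inj₁ x∈box with ∈-singletonIf⁻ x∈box
  ...   | c≤αₙ , x≡ = suc n , ≤-refl , c≤αₙ , x≡
  ∈column⁻ c (suc n) x∈ | inj₂ x∈col with ∈column⁻ c n x∈col
  ...   | i , i≤n , c≤αᵢ , x≡ = i , m≤n⇒m≤1+n i≤n , c≤αᵢ , x≡

  ∈columnsUpTo⁻ : ∀ m {x} → x ∈ columnsUpTo m → ∃[ c ] (1 ≤ c × c ≤ m × x ∈ column c ℓ)
  ∈columnsUpTo⁻ (suc m) x∈ with ∈-++⁻ (column (suc m) ℓ) x∈
  ... | inj₁ x∈col  = suc m , s≤s z≤n , ≤-refl , x∈col
  ... | inj₂ x∈cols with ∈columnsUpTo⁻ m x∈cols
  ...   | c , 1≤c , c≤m , x∈col = c , 1≤c , m≤n⇒m≤1+n c≤m , x∈col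

  ∈filling⁻ : ∀ {x} → x ∈ filling → Placed x
  ∈filling⁻ x∈ with ∈columnsUpTo⁻ (sum α) x∈
  ... | c , 1≤c , _ , x∈col with ∈column⁻ c ℓ x∈col
  ...   | i , _ , c≤αᵢ , refl = placed 1≤c c≤αᵢ

  ∈column⁺ : ∀ c n {i} → 1 ≤ i → i ≤ n → c ≤ part α i → cell (rowOf c i) c i ∈ column c n
  ∈column⁺ c zero    (s≤s _) () _
  ∈column⁺ c (suc n) 1≤i i≤n c≤αᵢ with m≤n⇒m<n∨m≡n i≤n
  ... | inj₁ i<n  = ∈-++⁺ʳ (boxIf c (suc n)) (∈column⁺ c n 1≤i (s≤s⁻¹ i<n) c≤αᵢ)
  ... | inj₂ refl = ∈-++⁺ˡ (∈-singletonIf⁺ (c ≤? part α (suc n)) c≤αᵢ)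

  ∈columnsUpTo⁺ : ∀ m {c x} → 1 ≤ c → c ≤ m → x ∈ column c ℓ → x ∈ columnsUpTo m
  ∈columnsUpTo⁺ zero    (s≤s _) () _
  ∈columnsUpTo⁺ (suc m) 1≤c c≤m x∈col with m≤n⇒m<n∨m≡n c≤m
  ... | inj₁ c<m  = ∈-++⁺ʳ (column (suc m) ℓ) (∈columnsUpTo⁺ m 1≤c (s≤s⁻¹ c<m) x∈col)
  ... | inj₂ refl = ∈-++⁺ˡ x∈col

  ∈filling⁺ : ∀ {c i} → 1 ≤ c → c ≤ part α i → cell (rowOf c i) c i ∈ filling
  ∈filling⁺ {c} {i} 1≤c c≤αᵢ with 1≤part⇒index α (≤-trans 1≤c c≤αᵢ)
  ... | 1≤i , i≤ℓ =
    ∈columnsUpTo⁺ (sum α) 1≤c (≤-trans c≤αᵢ (part≤sum α i)) (∈column⁺ c ℓ 1≤i i≤ℓ c≤αᵢ)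

  col-column : ∀ c n {x} → x ∈ column c n → col x ≡ c
  col-column c n x∈ with ∈column⁻ c n x∈
  ... | _ , _ , _ , refl = refl

  entry-column : ∀ c n {x} → x ∈ column c n → entry x ≤ n
  entry-column c n x∈ with ∈column⁻ c n x∈
  ... | _ , i≤n , _ , refl = i≤n

  col-columnsUpTo : ∀ m {x} → x ∈ columnsUpTo m → col x ≤ m
  col-columnsUpTo m x∈ with ∈columnsUpTo⁻ m x∈
  ... | c , _ , c≤m , x∈col = ≤-trans (≤-reflexive (col-column c ℓ x∈col)) c≤m

  count-columnsUpTo : ∀ {P : Cell → Set} (P? : Decidable P) m →
                      count P? (columnsUpTo m) ≡ sumTo m (λ c → count P? (column c ℓ))
  count-columnsUpTo P? zero    = refl
  count-columnsUpTo P? (suc m) = trans (count-++ P? (column (suc m) ℓ) (columnsUpTo m))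
                                       (cong (count P? (column (suc m) ℓ) +_) (count-columnsUpTo P? m))

  countEntry-column : ∀ c n {i} → 1 ≤ i → i ≤ n → count (entry≟ i) (column c n) ≡ 𝟙 (c ≤? part α i)
  countEntry-column c zero    (s≤s _) ()
  countEntry-column c (suc n) {i} 1≤i i≤n with m≤n⇒m<n∨m≡n i≤n
  ... | inj₁ i<n = begin
    count (entry≟ i) (boxIf c (suc n) ++ column c n)
      ≡⟨ count-++ (entry≟ i) (boxIf c (suc n)) (column c n) ⟩
    count (entry≟ i) (boxIf c (suc n)) + count (entry≟ i) (column c n)
      ≡⟨ cong (_+ count (entry≟ i) (column c n)) (count-none (entry≟ i) (boxIf c (suc n)) boxEntry≢i) ⟩
    count (entry≟ i) (column c n)
      ≡⟨ countEntry-column c n 1≤i (s≤s⁻¹ i<n) ⟩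
    𝟙 (c ≤? part α i) ∎
    where
    open ≡-Reasoning
    boxEntry≢i : ∀ {x} → x ∈ boxIf c (suc n) → ¬ entry x ≡ i
    boxEntry≢i x∈ entry≡i = <⇒≢ i<n (trans (sym entry≡i) (cong entry (proj₂ (∈-singletonIf⁻ x∈))))
  ... | inj₂ refl = begin
    count (entry≟ i) (boxIf c i ++ column c n)
      ≡⟨ count-++ (entry≟ i) (boxIf c i) (column c n) ⟩
    count (entry≟ i) (boxIf c i) + count (entry≟ i) (column c n)
      ≡⟨ cong₂ _+_ (count-singletonIf (entry≟ i) (c ≤? part α i) refl)
                   (count-none (entry≟ i) (column c n) columnEntry≢i) ⟩
    𝟙 (c ≤? part α i) + 0
      ≡⟨ +-identityʳ _ ⟩
    𝟙 (c ≤? part α i) ∎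
    where
    open ≡-Reasoning
    columnEntry≢i : ∀ {x} → x ∈ column c n → ¬ entry x ≡ i
    columnEntry≢i x∈ entry≡i = 1+n≰n (subst (_≤ n) entry≡i (entry-column c n x∈))

  countEntry-filling : ∀ i → 1 ≤ i → i ≤ ℓ → countEntry i filling ≡ part α i
  countEntry-filling i 1≤i i≤ℓ = begin
    countEntry i filling
      ≡⟨ count-columnsUpTo (entry≟ i) (sum α) ⟩
    sumTo (sum α) (λ c → count (entry≟ i) (column c ℓ))
      ≡⟨ sumTo-cong (sum α) (λ {c} _ _ → countEntry-column c ℓ 1≤i i≤ℓ) ⟩
    sumTo (sum α) (λ c → 𝟙 (c ≤? part α i))
      ≡⟨ sumTo-𝟙≤ (sum α) (part α i) ⟩
    sum α ⊓ part α i
      ≡⟨ m≥n⇒m⊓n≡n (part≤sum α i) ⟩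
    part α i ∎
    where open ≡-Reasoning

  countEntryCol-column : ∀ {i c₀} → 1 ≤ i → i ≤ ℓ → c₀ ≤ part α i → ∀ c →
                         count (entry,col≟ i c₀) (column c ℓ) ≡ 𝟙 (c ≟ c₀)
  countEntryCol-column {i} {c₀} 1≤i i≤ℓ c₀≤αᵢ c with c ≟ c₀
  ... | yes refl = begin
    count (entry,col≟ i c) (column c ℓ)
      ≡⟨ count-cong (entry,col≟ i c) (entry≟ i) (column c ℓ) (λ _ → proj₁)
                    (λ x∈ entry≡i → entry≡i , col-column c ℓ x∈) ⟩
    count (entry≟ i) (column c ℓ)
      ≡⟨ countEntry-column c ℓ 1≤i i≤ℓ ⟩
    𝟙 (c ≤? part α i)
      ≡⟨ 𝟙-yes (c ≤? part α i) c₀≤αᵢ ⟩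
    1 ∎
    where open ≡-Reasoning
  ... | no c≢c₀ = count-none (entry,col≟ i c₀) (column c ℓ)
                    (λ x∈ entry,col → c≢c₀ (trans (sym (col-column c ℓ x∈)) (proj₂ entry,col)))

  countEntryCol-filling : ∀ i → 1 ≤ i → i ≤ ℓ → ∀ c₀ → 1 ≤ c₀ → c₀ ≤ part α i →
                          countEntryCol i c₀ filling ≡ 1
  countEntryCol-filling i 1≤i i≤ℓ c₀ 1≤c₀ c₀≤αᵢ = begin
    countEntryCol i c₀ filling
      ≡⟨ count-columnsUpTo (entry,col≟ i c₀) (sum α) ⟩
    sumTo (sum α) (λ c → count (entry,col≟ i c₀) (column c ℓ))
      ≡⟨ sumTo-cong (sum α) (λ {c} _ _ → countEntryCol-column 1≤i i≤ℓ c₀≤αᵢ c) ⟩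
    sumTo (sum α) (λ c → 𝟙 (c ≟ c₀))
      ≡⟨ sumTo-𝟙≟ (sum α) 1≤c₀ (≤-trans c₀≤αᵢ (part≤sum α i)) ⟩
    1 ∎
    where open ≡-Reasoning

module KeyTableau {α : List ℕ} (R : RowAssignment α) where
  open RowAssignment R
  open KeyFilling α rowOf

  unique-column : ∀ {c} → 1 ≤ c → ∀ n → Unique (map pos (column c n))
  unique-column     1≤c zero    = []
  unique-column {c} 1≤c (suc n) rewrite map-++ pos (boxIf c (suc n)) (column c n) =
    Unique.++⁺ (Unique-map-singletonIf pos (c ≤? part α (suc n)) _) (unique-column 1≤c n) disjoint
    where
    disjoint : ∀ {v} → ¬ (v ∈ map pos (boxIf c (suc n)) × v ∈ map pos (column c n))
    disjoint (v∈box , v∈col) with ∈-map⁻ pos v∈box | ∈-map⁻ pos v∈col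
    ... | x , x∈box , refl | y , y∈col , pos≡
        with ∈-singletonIf⁻ {b? = c ≤? part α (suc n)} x∈box | ∈column⁻ c n y∈col
    ...   | c≤αₙ , refl | i , i≤n , c≤αᵢ , refl =
      <⇒≢ (rowOf-strictMono 1≤c c≤αᵢ c≤αₙ (s≤s i≤n)) (sym (cong proj₁ pos≡))

  unique-columnsUpTo : ∀ m → Unique (map pos (columnsUpTo m))
  unique-columnsUpTo zero    = []
  unique-columnsUpTo (suc m) rewrite map-++ pos (column (suc m) ℓ) (columnsUpTo m) =
    Unique.++⁺ (unique-column (s≤s z≤n) ℓ) (unique-columnsUpTo m) disjoint
    where
    disjoint : ∀ {v} → ¬ (v ∈ map pos (column (suc m) ℓ) × v ∈ map pos (columnsUpTo m))
    disjoint (v∈col , v∈cols) with ∈-map⁻ pos v∈col | ∈-map⁻ pos v∈cols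
    ... | x , x∈col , refl | y , y∈cols , pos≡ = n≮n m (begin-strict
      m       <⟨ ≤-refl ⟩
      suc m   ≡⟨ sym (col-column (suc m) ℓ x∈col) ⟩
      col x   ≡⟨ cong proj₂ pos≡ ⟩
      col y   ≤⟨ col-columnsUpTo m y∈cols ⟩
      m       ∎)
      where open ≤-Reasoning

  isKohnertTableau : IsKohnertTableau α filling
  isKohnertTableau = record
    { cellsPositive   = All.tabulate positive
    ; distinctCells   = unique-columnsUpTo (sum α)
    ; entriesInRange  = All.tabulate entryInRange
    ; content         = countEntry-filling
    ; oneInEachColumn = countEntryCol-filling
    ; entryBelowRow   = All.tabulate rowBelowEntry
    ; weaklyDescend   = weaklyDescend
    ; columnCondition = columnCondition
    }
    where
    positive : ∀ {x} → x ∈ filling → (1 ≤ row x) × (1 ≤ col x)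
    positive x∈ with ∈filling⁻ x∈
    ... | placed 1≤c c≤αᵢ = rowOf-positive 1≤c c≤αᵢ , 1≤c

    entryInRange : ∀ {x} → x ∈ filling → (1 ≤ entry x) × (entry x ≤ ℓ)
    entryInRange x∈ with ∈filling⁻ x∈
    ... | placed 1≤c c≤αᵢ = 1≤part⇒index α (≤-trans 1≤c c≤αᵢ)

    rowBelowEntry : ∀ {x} → x ∈ filling → row x ≤ entry x
    rowBelowEntry x∈ with ∈filling⁻ x∈
    ... | placed 1≤c c≤αᵢ = rowOf≤entry 1≤c c≤αᵢ

    weaklyDescend : ∀ x y → x ∈ filling → y ∈ filling → entry x ≡ entry y → col x < col y → row y ≤ row x
    weaklyDescend _ _ x∈ y∈ same-entry c<c′ with ∈filling⁻ x∈ | ∈filling⁻ y∈ | same-entry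
    ... | placed 1≤c _ | placed _ c′≤αᵢ | refl = rowOf-antitone 1≤c c<c′ c′≤αᵢ

    columnCondition : ∀ x y → x ∈ filling → y ∈ filling → col x ≡ col y → entry x < entry y → row y < row x →
                      ∃[ z ] (z ∈ filling × entry z ≡ entry x × col z ≡ suc (col y) × row y < row z)
    columnCondition _ _ x∈ y∈ same-col i<j above with ∈filling⁻ x∈ | ∈filling⁻ y∈ | same-col
    ... | placed 1≤c c≤αᵢ | placed _ c≤αⱼ | refl =
      ⊥-elim (<-asym above (rowOf-strictMono 1≤c c≤αᵢ c≤αⱼ i<j))

  quasiYamanouchi : Strong α → QuasiYamanouchi filling
  quasiYamanouchi strong x x∈ with ∈filling⁻ x∈
  ... | placed {c} {i} 1≤c c≤αᵢ =
    inj₁ ( cell (rowOf 1 r) 1 r , ∈filling⁺ (s≤s z≤n) (Strong⇒1≤part strong 1≤r r≤ℓ)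
         , rowOf-firstColumn 1≤r r≤ℓ , refl )
    where
    r : ℕ
    r = rowOf c i
    1≤r : 1 ≤ r
    1≤r = rowOf-positive 1≤c c≤αᵢ
    r≤ℓ : r ≤ ℓ
    r≤ℓ = ≤-trans (rowOf≤entry 1≤c c≤αᵢ) (proj₂ (1≤part⇒index α (≤-trans 1≤c c≤αᵢ)))

  isQKT : Strong α → IsQKT α filling
  isQKT strong = isKohnertTableau , quasiYamanouchi strong

keyTableau : ∀ {α} → RowAssignment α → Filling
keyTableau {α} R = KeyFilling.filling α (RowAssignment.rowOf R)

applyUpTo-part : ∀ xs {h : ℕ → ℕ} → (∀ {k} → suc k ≤ length xs → h k ≡ part xs (suc k)) →
                 applyUpTo h (length xs) ≡ xs
applyUpTo-part []       h≗ = refl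
applyUpTo-part (x ∷ xs) h≗ = cong₂ _∷_ (h≗ (s≤s z≤n)) (applyUpTo-part xs (h≗ ∘ s≤s))

wt-countRow : ∀ T xs → (∀ {r} → 1 ≤ r → r ≤ length xs → countRow r T ≡ part xs r) →
              wt (length xs) T ≡ xs
wt-countRow T xs countRow≗ = trans (map-applyUpTo (λ k → k) (λ k → countRow (suc k) T) (length xs))
                                   (applyUpTo-part xs (countRow≗ (s≤s z≤n)))

identityRows : (α : List ℕ) → RowAssignment α
identityRows α = record
  { rowOf             = λ _ i → i
  ; rowOf-positive    = λ 1≤c c≤αᵢ → proj₁ (1≤part⇒index α (≤-trans 1≤c c≤αᵢ))
  ; rowOf≤entry       = λ _ _ → ≤-refl
  ; rowOf-firstColumn = λ _ _ → refl
  ; rowOf-antitone    = λ _ _ _ → ≤-refl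
  ; rowOf-strictMono  = λ _ _ _ i<j → i<j
  }

wt-identityRows : ∀ α → wt (length α) (keyTableau (identityRows α)) ≡ α
wt-identityRows α = wt-countRow filling α λ {r} 1≤r r≤ℓ →
  trans (count-cong (row≟ r) (entry≟ r) filling (λ x∈ → trans (sym (row≡entry x∈))) (λ x∈ → trans (row≡entry x∈)))
        (countEntry-filling r 1≤r r≤ℓ)
  where
  open KeyFilling α (λ _ i → i)
  row≡entry : ∀ {x} → x ∈ filling → row x ≡ entry x
  row≡entry x∈ with ∈filling⁻ x∈
  ... | placed _ _ = refl

height : ℕ → List ℕ → ℕ
height c = count (c ≤?_)

height-↭ : ∀ c {xs ys} → xs ↭ ys → height c xs ≡ height c ys
height-↭ c xs↭ys = ↭-length (filter-↭ (c ≤?_) xs↭ys)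

height-sorted : ∀ {xs} → Linked _≥_ xs → ∀ {c} → 1 ≤ c → ∀ r →
                𝟙 (suc r ≤? height c xs) ≡ 𝟙 (c ≤? part xs (suc r))
height-sorted {[]}     _      {c} 1≤c r = 𝟙-cong (λ ()) (⊥-elim ∘ <⇒≱ 1≤c) (suc r ≤? 0) (c ≤? 0)
height-sorted {x ∷ xs} sorted {c} 1≤c r = byCases (c ≤? x) r
  where
  bounded : All (_≤ x) (x ∷ xs)
  bounded with Linked⇒AllPairs (λ y≤x z≤y → ≤-trans z≤y y≤x) sorted
  ... | xs≤x ∷ _ = ≤-refl ∷ xs≤x

  byCases : Dec (c ≤ x) → ∀ r → 𝟙 (suc r ≤? height c (x ∷ xs)) ≡ 𝟙 (c ≤? part (x ∷ xs) (suc r))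
  byCases (yes c≤x) r = begin
    𝟙 (suc r ≤? height c (x ∷ xs))
      ≡⟨ cong (λ h → 𝟙 (suc r ≤? h)) (count-∷ (c ≤?_) x xs) ⟩
    𝟙 (suc r ≤? 𝟙 (c ≤? x) + height c xs)
      ≡⟨ cong (λ one → 𝟙 (suc r ≤? one + height c xs)) (𝟙-yes (c ≤? x) c≤x) ⟩
    𝟙 (suc r ≤? suc (height c xs))
      ≡⟨ onTop r ⟩
    𝟙 (c ≤? part (x ∷ xs) (suc r)) ∎
    where
    open ≡-Reasoning
    onTop : ∀ r → 𝟙 (suc r ≤? suc (height c xs)) ≡ 𝟙 (c ≤? part (x ∷ xs) (suc r))
    onTop zero    = 𝟙-cong (λ _ → c≤x) (λ _ → s≤s z≤n) (1 ≤? suc (height c xs)) (c ≤? x)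
    onTop (suc r) = trans (𝟙-cong s≤s⁻¹ s≤s (suc (suc r) ≤? suc (height c xs)) (suc r ≤? height c xs))
                          (height-sorted (Linked.tail sorted) 1≤c r)
  byCases (no c≰x) r =
    𝟙-cong (λ r<h → ⊥-elim (n≮0 (subst (suc r ≤_) height≡0 r<h)))
           (λ c≤part → ⊥-elim (c≰x (≤-trans c≤part (part≤ (x ∷ xs) bounded (suc r))))) _ _
    where
    height≡0 : height c (x ∷ xs) ≡ 0
    height≡0 = count-none (c ≤?_) (x ∷ xs) (λ y∈ c≤y → c≰x (≤-trans c≤y (All.lookup bounded y∈)))

heightUpTo : List ℕ → ℕ → ℕ → ℕ
heightUpTo α c n = sumTo n (λ j → 𝟙 (c ≤? part α j))

heightUpTo-suc : ∀ α {c n} → c ≤ part α (suc n) → heightUpTo α c (suc n) ≡ suc (heightUpTo α c n)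
heightUpTo-suc α {c} {n} c≤αₙ = cong (_+ heightUpTo α c n) (𝟙-yes (c ≤? part α (suc n)) c≤αₙ)

heightUpTo-length : ∀ xs c → heightUpTo xs c (length xs) ≡ height c xs
heightUpTo-length []       c = refl
heightUpTo-length (x ∷ xs) c = begin
  heightUpTo (x ∷ xs) c (suc (length xs))
    ≡⟨ sumTo-suc (length xs) _ ⟩
  𝟙 (c ≤? x) + sumTo (length xs) (λ j → 𝟙 (c ≤? part (x ∷ xs) (suc j)))
    ≡⟨ cong (𝟙 (c ≤? x) +_) (sumTo-cong (length xs) shift) ⟩
  𝟙 (c ≤? x) + heightUpTo xs c (length xs)
    ≡⟨ cong (𝟙 (c ≤? x) +_) (heightUpTo-length xs c) ⟩
  𝟙 (c ≤? x) + height c xs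
    ≡⟨ count-∷ (c ≤?_) x xs ⟨
  height c (x ∷ xs) ∎
  where
  open ≡-Reasoning
  shift : ∀ {j} → 1 ≤ j → j ≤ length xs → 𝟙 (c ≤? part (x ∷ xs) (suc j)) ≡ 𝟙 (c ≤? part xs j)
  shift {suc j} _ _ = refl

leftJustifiedRow : List ℕ → ℕ → ℕ → ℕ
leftJustifiedRow α c i = suc (heightUpTo α c (pred i))

leftJustifiedRows : (α : List ℕ) → Strong α → RowAssignment α
leftJustifiedRows α strong = record
  { rowOf             = leftJustifiedRow α
  ; rowOf-positive    = λ _ _ → s≤s z≤n
  ; rowOf≤entry       = rowOf≤entry
  ; rowOf-firstColumn = rowOf-firstColumn
  ; rowOf-antitone    = λ {_} {_} {i} _ c<c′ _ →
                          s≤s (sumTo-mono (pred i) (λ j → 𝟙-antitone (part α j) (<⇒≤ c<c′)))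
  ; rowOf-strictMono  = rowOf-strictMono
  }
  where
  index≡suc : ∀ {c i} → 1 ≤ c → c ≤ part α i → ∃[ k ] (i ≡ suc k)
  index≡suc {i = suc k} _ _ = k , refl
  index≡suc {i = zero}  1≤c c≤α₀ with 1≤part⇒index α (≤-trans 1≤c c≤α₀)
  ... | () , _

  rowOf≤entry : ∀ {c i} → 1 ≤ c → c ≤ part α i → leftJustifiedRow α c i ≤ i
  rowOf≤entry 1≤c c≤αᵢ with index≡suc 1≤c c≤αᵢ
  ... | k , refl = s≤s (sumTo-≤ k (λ j → 𝟙≤1 _))

  rowOf-firstColumn : ∀ {i} → 1 ≤ i → i ≤ length α → leftJustifiedRow α 1 i ≡ i
  rowOf-firstColumn {suc k} _ k<ℓ = cong suc (sumTo-one k λ 1≤j j≤k →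
    𝟙-yes (1 ≤? part α _) (Strong⇒1≤part strong 1≤j (≤-trans j≤k (<⇒≤ k<ℓ))))

  rowOf-strictMono : ∀ {c i j} → 1 ≤ c → c ≤ part α i → c ≤ part α j → i < j →
                     leftJustifiedRow α c i < leftJustifiedRow α c j
  rowOf-strictMono 1≤c c≤αᵢ c≤αⱼ i<j with index≡suc 1≤c c≤αᵢ | index≡suc 1≤c c≤αⱼ
  ... | k , refl | k′ , refl =
    s≤s (≤-trans (≤-reflexive (sym (heightUpTo-suc α c≤αᵢ))) (sumTo-monoˡ _ (s≤s⁻¹ i<j)))

module LeftJustified (α : List ℕ) where
  open KeyFilling α (leftJustifiedRow α)
  open Sort (DecTotalOrder.≥-decTotalOrder ≤-decTotalOrder) using (sort-↭; sort-↗)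

  countRow-column : ∀ c n r → count (row≟ (suc r)) (column c n) ≡ 𝟙 (suc r ≤? heightUpTo α c n)
  countRow-column c zero    r = sym (𝟙-no (suc r ≤? 0) (λ ()))
  countRow-column c (suc n) r =
    trans (count-++ (row≟ (suc r)) (boxIf c (suc n)) (column c n)) (withBox (c ≤? part α (suc n)))
    where
    k : ℕ
    k = heightUpTo α c n
    withBox : (b? : Dec (c ≤ part α (suc n))) →
              count (row≟ (suc r)) (singletonIf b? (cell (suc k) c (suc n))) + count (row≟ (suc r)) (column c n)
              ≡ 𝟙 (suc r ≤? 𝟙 b? + k)
    withBox (yes _) = trans (cong₂ _+_ (trans (count-∷ (row≟ (suc r)) _ []) (+-identityʳ _))
                                       (countRow-column c n r))
                            (𝟙-≤-suc r k)
    withBox (no _)  = countRow-column c n r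

  countRow-filling : ∀ {r} → 1 ≤ r → r ≤ length (sortDesc α) → countRow r filling ≡ part (sortDesc α) r
  countRow-filling {suc r} _ _ = begin
    countRow (suc r) filling
      ≡⟨ count-columnsUpTo (row≟ (suc r)) (sum α) ⟩
    sumTo (sum α) (λ c → count (row≟ (suc r)) (column c ℓ))
      ≡⟨ sumTo-cong (sum α) (λ {c} 1≤c _ → columnRows c 1≤c) ⟩
    sumTo (sum α) (λ c → 𝟙 (c ≤? part (sortDesc α) (suc r)))
      ≡⟨ sumTo-𝟙≤ (sum α) _ ⟩
    sum α ⊓ part (sortDesc α) (suc r)
      ≡⟨ m≥n⇒m⊓n≡n (≤-trans (part≤sum (sortDesc α) (suc r)) (≤-reflexive (sum-↭ (sort-↭ α)))) ⟩
    part (sortDesc α) (suc r) ∎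
    where
    open ≡-Reasoning
    columnRows : ∀ c → 1 ≤ c → count (row≟ (suc r)) (column c ℓ) ≡ 𝟙 (c ≤? part (sortDesc α) (suc r))
    columnRows c 1≤c = begin
      count (row≟ (suc r)) (column c ℓ)
        ≡⟨ countRow-column c ℓ r ⟩
      𝟙 (suc r ≤? heightUpTo α c ℓ)
        ≡⟨ cong (λ h → 𝟙 (suc r ≤? h)) (trans (heightUpTo-length α c) (height-↭ c (↭-sym (sort-↭ α)))) ⟩
      𝟙 (suc r ≤? height c (sortDesc α))
        ≡⟨ height-sorted (sort-↗ α) 1≤c r ⟩
      𝟙 (c ≤? part (sortDesc α) (suc r)) ∎

  wt-filling : wt (length α) filling ≡ sortDesc α
  wt-filling = subst (λ n → wt n filling ≡ sortDesc α) (↭-length (sort-↭ α))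
                     (wt-countRow filling (sortDesc α) countRow-filling)

lemma3p8 : (α : List ℕ) → Strong α →
           (∃[ T ] (IsQKT α T × wt (length α) T ≡ α))
           × (∃[ T′ ] (IsQKT α T′ × wt (length α) T′ ≡ sortDesc α))
lemma3p8 α strong =
    (keyTableau keyRows       , KeyTableau.isQKT keyRows strong       , wt-identityRows α)
  , (keyTableau justifiedRows , KeyTableau.isQKT justifiedRows strong , LeftJustified.wt-filling α)
  where
  keyRows justifiedRows : RowAssignment α
  keyRows       = identityRows α
  justifiedRows = leftJustifiedRows α strong
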